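{- Let $a$ be a natural number. Suppose that $\mathrm{cat}(K_n)=c_n$ for all $2\leq n\leq 3\cdot 2^a+1$. Let $G$ be the graph obtained from the complete graph $K_{3\cdot 2^a}$ by adding one new vertex joined by a single (pendant) edge to one vertex of $K_{3\cdot 2^a}$. Then $\mathrm{cat}(G)=\mathrm{cat}(K_{3\cdot 2^a})+1$.
   Context: Cat Herding is a two-player game on a finite simple graph $G$ between a cat and a herder. First the cat places its token on a starting vertex. Then the players alternate, the herder moving first: on the herder's turn it deletes one edge of the current graph (a "cut"); on the cat's turn the cat must move its token along a path of the current graph to a different vertex. The game ends when the cat's current vertex has no incident edges. The score is the total number of edges deleted; the herder minimizes and the cat maximizes it. For $v\in V(G)$, $\mathrm{cat}(G,v)$ is the optimal-play score when the cat starts at $v$, and $\mathrm{cat}(G)=\max_{v\in V(G)}\mathrm{cat}(G,v)$. The sequence $(c_n)_{n\geq 2}$ is defined by $c_2=1$, $c_3=2$, and $c_n=\lfloor \frac{n}{2}\rfloor\lceil \frac{n}{2}\rceil+c_{\lceil n/2\rceil}$ for $n>3$. -}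

module Defs where

open import Data.Nat using (ℕ; zero; suc; _+_; _*_; _∸_; _⊔_; _⊓_; _/_; _≤ᵇ_)
open import Data.Bool using (Bool; true; false; if_then_else_; _∧_; _∨_; not)
open import Data.Fin using (Fin; toℕ; fromℕ; inject₁; _<?_)
import Data.Fin as F
open import Data.Fin.Properties renaming (_≟_ to _≟ᶠ_)
open import Data.Bool.ListAction using (any)
open import Data.List using (List; []; _∷_; length; map; foldr; concatMap; filter; allFin; _++_)
open import Data.Product using (_×_; _,_)
open import Relation.Nullary.Decidable using (⌊_⌋)

-- A finite simple graph on vertex set Fin n, given by its list of edges
-- (each edge an unordered pair stored once as an ordered pair).
Edge : ℕ → Set
Edge n = Fin n × Fin n

Graph : ℕ → Set
Graph n = List (Edge n)

_==_ : ∀ {n} → Fin n → Fin n → Bool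
x == y = ⌊ x ≟ᶠ y ⌋

incident : ∀ {n} → Fin n → Graph n → Bool
incident v E = any (λ { (x , y) → (x == v) ∨ (y == v) }) E

step : ∀ {n} → Graph n → (Fin n → Bool) → (Fin n → Bool)
step E R u = R u ∨ any (λ { (x , y) → ((x == u) ∧ R y) ∨ ((y == u) ∧ R x) }) E

iter : ∀ {n} → ℕ → Graph n → (Fin n → Bool) → (Fin n → Bool)
iter zero E R = R
iter (suc k) E R = iter k E (step E R)

-- reach E v u : there is a path from v to u in E (paths have length < n)
reach : ∀ {n} → Graph n → Fin n → Fin n → Bool
reach {n} E v = iter n E (λ u → u == v)

picks : ∀ {A : Set} → List A → List (A × List A)
picks [] = []
picks (x ∷ xs) = (x , xs) ∷ map (λ { (y , ys) → (y , x ∷ ys) }) (picks xs)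

minList : List ℕ → ℕ
minList [] = 0
minList (x ∷ xs) = foldr _⊓_ x xs

maxFin : ∀ {n} → (Fin n → ℕ) → ℕ
maxFin {n} f = foldr (λ i m → f i ⊔ m) 0 (allFin n)

-- The fuel argument k is the number of edges of the current
-- graph (each herder move deletes exactly one edge).
-- herderVal k E v : herder to move, cat at v, current edge list E.
-- catVal   k E v  : cat to move (after a cut), cat at v.
mutual
  herderVal : ∀ {n} → ℕ → Graph n → Fin n → ℕ
  herderVal zero E v = 0
  herderVal (suc k) E v =
    if incident v E
    then minList (map (λ { (e , rest) → suc (catVal k rest v) }) (picks E))
    else 0

  catVal : ∀ {n} → ℕ → Graph n → Fin n → ℕ
  catVal k E v =
    if incident v E
    then maxFin (λ u → if not (u == v) ∧ reach E v u then herderVal k E u else 0)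
    else 0

catAt : ∀ {n} → Graph n → Fin n → ℕ
catAt E v = herderVal (length E) E v

cat : ∀ {n} → Graph n → ℕ
cat E = maxFin (catAt E)

K : (n : ℕ) → Graph n
K n = concatMap (λ i → map (λ j → (i , j)) (filter (λ j → i <? j) (allFin n))) (allFin n)

pendant : (m : ℕ) → Fin m → Graph (suc m)
pendant m w = map (λ { (i , j) → (inject₁ i , inject₁ j) }) (K m) ++ ((fromℕ m , inject₁ w) ∷ [])

-- the sequence c_n : c_2 = 1, c_3 = 2, c_n = ⌊n/2⌋⌈n/2⌉ + c_{⌈n/2⌉} (n > 3);
-- values at n = 0, 1 are irrelevant (set to 0).  Fuel f ≥ n suffices.
cAux : ℕ → ℕ → ℕ
cAux zero n = 0
cAux (suc f) 0 = 0
cAux (suc f) 1 = 0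
cAux (suc f) 2 = 1
cAux (suc f) 3 = 2
cAux (suc f) n@(suc (suc (suc (suc _)))) = (n / 2) * (n ∸ n / 2) + cAux f (n ∸ n / 2)

c : ℕ → ℕ
c n = cAux n n

{-# OPTIONS --safe #-}
module Submission where

-- Let m = 3·2^a and G = pendant m w. Cutting the pendant edge first leaves K_m plus an isolated
-- vertex, which plays exactly like K_m, so cat(G) ≤ cat(K_m) + 1. Conversely, K_{m+1} is G together
-- with the m − 1 other edges at the new vertex, and cutting those first gives
-- cat(K_{m+1}) ≤ (m − 1) + cat(G). For m = 3·2^a the recursion gives c_{m+1} = c_m + m (induction
-- on a, using c_{2k+1} − c_{2k} = c_{k+1} − c_k + k), so with cat(K_n) = c_n the second bound
-- becomes cat(G) ≥ cat(K_m) + 1. Comparing K_{m+1} with G needs that game values depend only on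
-- the multiset of undirected edges, not on the order and orientation in which they are listed.

open import Defs
open import Data.Nat using (ℕ; zero; suc; pred; _+_; _*_; _∸_; _⊔_; _⊓_; _≤_; _<_; z≤n; s≤s; s≤s⁻¹; _^_; _/_)
open import Data.Nat.Divisibility using (divides-refl)
open import Data.Nat.Tactic.RingSolver using (solve-∀)
open import Data.Nat.DivMod using (m≥n⇒m/n>0; m/n≤m; m*n/n≡m; +-distrib-/-∣ʳ)
open import Data.Nat.Properties hiding (_<?_)
open import Data.Bool using (Bool; true; false; if_then_else_; _∧_; _∨_; not)
import Data.Bool as Bool
open import Data.Bool.Properties using (∨-comm; ∨-isCommutativeMonoid; ≡-setoid)
open import Data.Bool.ListAction using (any; or)
import Data.Fin as Fin
open import Data.Fin using (Fin; toℕ; fromℕ; inject₁; _<?_)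
open import Data.Fin.Properties
  using (fromℕ≢inject₁; inject₁-injective; all?; ¬∀⟶∃¬; toℕ-fromℕ; toℕ-inject₁; inject₁ℕ<; ≤fromℕ)
  renaming (_≟_ to _≟ᶠ_)
open import Data.List using (List; []; _∷_; length; map; foldr; concat; allFin; tabulate; filter; _++_; [_])
open import Data.List.Properties
  using (map-cong; map-∘; map-++; length-map; map-tabulate; filter-++; filter-accept; filter-none; filter-≐;
         ++-assoc; ++-identityʳ; concat-map; concatMap-++; length-++-sucʳ; length-tabulate)
import Data.List.Relation.Unary.All as All
open import Data.List.Membership.Propositional using (_∈_)
open import Data.List.Membership.Propositional.Properties using (∈-map⁺; ∈-map⁻; ∈-∃++; ∈-allFin)
open import Data.List.Relation.Binary.Subset.Propositional using (_⊆_)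
open import Data.List.Relation.Unary.Any using (here; there)
open import Data.List.Relation.Binary.Permutation.Propositional
  using (_↭_; ↭-refl; ↭-sym; ↭-trans; ↭-prep; ↭-swap; ↭-reflexive; ↭⇒↭ₛ; module PermutationReasoning)
open import Data.List.Relation.Binary.Permutation.Propositional.Properties
  using (map⁺; drop-mid; ∈-resp-↭; ↭-length; ++⁺ˡ; shift; ++-comm; ∷↭∷ʳ)
open import Data.List.Relation.Binary.Permutation.Setoid.Properties ≡-setoid
  using (foldr-commMonoid)
import Data.Vec as Vec
open import Data.Vec.Properties using (lookup∘tabulate; lookup⇒[]=; []=⇒lookup)
open import Data.Empty using (⊥-elim)
import Data.Product as Product
open import Data.Product using (∃; ∃₂; _×_; _,_; proj₁)
open import Data.Sum using (_⊎_; inj₁; inj₂)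
open import Data.Fin.Subset using (Subset; ∣_∣; ⊤) renaming (_∈_ to _∈ˢ_)
open import Data.Fin.Subset.Properties using (∈⊤; ∣p∣≤n; ∣p∣≡n⇒p≡⊤; p⊂q⇒∣p∣<∣q∣)
open import Data.Fin.Relation.Unary.Top using (view; ‵fromℕ; ‵inject₁)
open import Function using (_∘_; id)
open import Relation.Nullary using (yes; no; does; ¬_; contradiction)
open import Relation.Unary using (Pred; Decidable; _≐_)
open import Relation.Nullary.Decidable using (dec-true; dec-false; isYes≗does)
open import Relation.Binary.PropositionalEquality hiding ([_])

any-cong : ∀ {A : Set} {p q : A → Bool} → p ≗ q → any p ≗ any q
any-cong p≗q xs = cong or (map-cong p≗q xs)

any-map : ∀ {A B : Set} (p : B → Bool) (f : A → B) → any p ∘ map f ≗ any (p ∘ f)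
any-map p f xs = cong or (sym (map-∘ xs))

any-false : ∀ {A : Set} {p : A → Bool} → (∀ x → p x ≡ false) → ∀ xs → any p xs ≡ false
any-false p≡false [] = refl
any-false p≡false (x ∷ xs) rewrite p≡false x = any-false p≡false xs

any-↭ : ∀ {A : Set} (p : A → Bool) {xs ys : List A} → xs ↭ ys → any p xs ≡ any p ys
any-↭ p xs↭ys = foldr-commMonoid ∨-isCommutativeMonoid (↭⇒↭ₛ (map⁺ p xs↭ys))

strict-increase : ∀ {s t : Bool} → (s ≡ true → t ≡ true) → t ≢ s → s ≡ false × t ≡ true
strict-increase {true}          s⇒t t≢s = ⊥-elim (t≢s (s⇒t refl))
strict-increase {false} {true}  _   _   = refl , refl
strict-increase {false} {false} _   t≢s = ⊥-elim (t≢s refl)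

foldr-⊓-≤ : ∀ {x} y ys → x ∈ y ∷ ys → foldr _⊓_ y ys ≤ x
foldr-⊓-≤ y []       (here refl)          = ≤-refl
foldr-⊓-≤ y (z ∷ zs) (there (here refl))  = m⊓n≤m z _
foldr-⊓-≤ y (z ∷ zs) (here refl)          = ≤-trans (m⊓n≤n z _) (foldr-⊓-≤ y zs (here refl))
foldr-⊓-≤ y (z ∷ zs) (there (there x∈zs)) = ≤-trans (m⊓n≤n z _) (foldr-⊓-≤ y zs (there x∈zs))

minList-≤ : ∀ {x} xs → x ∈ xs → minList xs ≤ x
minList-≤ (y ∷ ys) = foldr-⊓-≤ y ys

minList-∈ : ∀ x xs → minList (x ∷ xs) ∈ x ∷ xs
minList-∈ x []       = here refl
minList-∈ x (y ∷ ys) with ⊓-sel y (minList (x ∷ ys))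
... | inj₁ eq rewrite eq = there (here refl)
... | inj₂ eq rewrite eq with minList-∈ x ys
...   | here  m≡x  = here m≡x
...   | there m∈ys = there (there m∈ys)

minList-⊆-cong : ∀ {xs ys} → xs ⊆ ys → ys ⊆ xs → minList xs ≡ minList ys
minList-⊆-cong {[]}     {[]}     _     _     = refl
minList-⊆-cong {[]}     {y ∷ ys} _     ys⊆xs with () ← ys⊆xs (here refl)
minList-⊆-cong {x ∷ xs} {[]}     xs⊆ys _     with () ← xs⊆ys (here refl)
minList-⊆-cong {x ∷ xs} {y ∷ ys} xs⊆ys ys⊆xs =
  ≤-antisym (minList-≤ (x ∷ xs) (ys⊆xs (minList-∈ y ys))) (minList-≤ (y ∷ ys) (xs⊆ys (minList-∈ x xs)))

module _ {A : Set} (f : A → ℕ) where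

  foldr-⊔-≥ : ∀ {x} xs → x ∈ xs → f x ≤ foldr (λ y m → f y ⊔ m) 0 xs
  foldr-⊔-≥ (y ∷ ys) (here refl)  = m≤m⊔n (f y) _
  foldr-⊔-≥ (y ∷ ys) (there x∈ys) = ≤-trans (foldr-⊔-≥ ys x∈ys) (m≤n⊔m (f y) _)

  foldr-⊔-lub : ∀ {b} → (∀ x → f x ≤ b) → ∀ xs → foldr (λ y m → f y ⊔ m) 0 xs ≤ b
  foldr-⊔-lub f≤b []       = z≤n
  foldr-⊔-lub f≤b (y ∷ ys) = ⊔-lub (f≤b y) (foldr-⊔-lub f≤b ys)

maxFin-≥ : ∀ {n} (f : Fin n → ℕ) i → f i ≤ maxFin f
maxFin-≥ {n} f i = foldr-⊔-≥ f (allFin n) (∈-allFin i)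

maxFin-lub : ∀ {n} {f : Fin n → ℕ} {b} → (∀ i → f i ≤ b) → maxFin f ≤ b
maxFin-lub {n} {f} f≤b = foldr-⊔-lub f f≤b (allFin n)

maxFin-mono : ∀ {n} {f g : Fin n → ℕ} → (∀ i → f i ≤ g i) → maxFin f ≤ maxFin g
maxFin-mono {g = g} f≤g = maxFin-lub (λ i → ≤-trans (f≤g i) (maxFin-≥ g i))

maxFin-cong : ∀ {n} {f g : Fin n → ℕ} → f ≗ g → maxFin f ≡ maxFin g
maxFin-cong f≗g = ≤-antisym (maxFin-mono (≤-reflexive ∘ f≗g)) (maxFin-mono (≤-reflexive ∘ sym ∘ f≗g))

maxFin-inject₁ : ∀ {m} {f : Fin (suc m) → ℕ} {g : Fin m → ℕ} →
                 f ∘ inject₁ ≗ g → f (fromℕ m) ≡ 0 → maxFin f ≡ maxFin g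
maxFin-inject₁ {m} {f} {g} f∘inject₁≗g f[top]≡0 =
  ≤-antisym (maxFin-lub f≤maxg)
            (maxFin-lub (λ i → ≤-trans (≤-reflexive (sym (f∘inject₁≗g i))) (maxFin-≥ f (inject₁ i))))
  where
  f≤maxg : ∀ i → f i ≤ maxFin g
  f≤maxg i with view i
  ... | ‵fromℕ     = ≤-trans (≤-reflexive f[top]≡0) z≤n
  ... | ‵inject₁ j = ≤-trans (≤-reflexive (f∘inject₁≗g j)) (maxFin-≥ g j)

picks-↭ : ∀ {A : Set} {x : A} {rest} xs → (x , rest) ∈ picks xs → xs ↭ x ∷ rest
picks-↭ (y ∷ ys) (here refl) = ↭-refl
picks-↭ (y ∷ ys) (there p∈) with ∈-map⁻ _ p∈
... | (z , zs) , z,zs∈ , refl = ↭-trans (↭-prep y (picks-↭ ys z,zs∈)) (↭-swap y z ↭-refl)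

picks-++ : ∀ {A : Set} (ys : List A) x zs → (x , ys ++ zs) ∈ picks (ys ++ x ∷ zs)
picks-++ []       x zs = here refl
picks-++ (y ∷ ys) x zs = there (∈-map⁺ _ (picks-++ ys x zs))

picks-map : ∀ {A B : Set} (f : A → B) xs → picks (map f xs) ≡ map (Product.map f (map f)) (picks xs)
picks-map f []       = refl
picks-map f (x ∷ xs) = cong ((f x , map f xs) ∷_) (begin
  map _ (picks (map f xs))                       ≡⟨ cong (map _) (picks-map f xs) ⟩
  map _ (map (Product.map f (map f)) (picks xs)) ≡⟨ map-∘ (picks xs) ⟨
  map _ (picks xs)                               ≡⟨ map-∘ (picks xs) ⟩
  map (Product.map f (map f)) (map _ (picks xs)) ∎)
  where open ≡-Reasoning

picks-map-↭ : ∀ {A B : Set} (f : A → B) xs {y ys} → map f xs ↭ y ∷ ys →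
              ∃₂ λ x rest → (x , rest) ∈ picks xs × map f rest ↭ ys
picks-map-↭ f xs {ys = ys} fxs↭ with ∈-map⁻ f (∈-resp-↭ (↭-sym fxs↭) (here refl))
... | x , x∈xs , refl with ∈-∃++ x∈xs
...   | us , vs , refl = x , us ++ vs , picks-++ us x vs ,
  subst (_↭ ys) (sym (map-++ f us vs))
        (drop-mid (map f us) [] (subst (_↭ f x ∷ ys) (map-++ f us (x ∷ vs)) fxs↭))

filter-map : ∀ {A B : Set} {p} {P : Pred B p} (P? : Decidable P) (f : A → B) xs →
             filter P? (map f xs) ≡ map f (filter (P? ∘ f) xs)
filter-map P? f []       = refl
filter-map P? f (x ∷ xs) with does (P? (f x))
... | true  = cong (f x ∷_) (filter-map P? f xs)
... | false = filter-map P? f xs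

tabulate-inject₁ : ∀ {A : Set} m (f : Fin (suc m) → A) → tabulate f ≡ tabulate (f ∘ inject₁) ++ [ f (fromℕ m) ]
tabulate-inject₁ zero    f = refl
tabulate-inject₁ (suc m) f = cong (f Fin.zero ∷_) (tabulate-inject₁ m (f ∘ Fin.suc))

concatMap-∷ʳ-↭ : ∀ {A B : Set} (F : A → List B) (b : A → B) xs →
                 concat (map (λ x → F x ++ [ b x ]) xs) ↭ concat (map F xs) ++ map b xs
concatMap-∷ʳ-↭ F b []       = ↭-refl
concatMap-∷ʳ-↭ F b (x ∷ xs) = begin
  (F x ++ [ b x ]) ++ concat (map (λ x → F x ++ [ b x ]) xs) ≡⟨ ++-assoc (F x) [ b x ] _ ⟩
  F x ++ b x ∷ concat (map (λ x → F x ++ [ b x ]) xs)       ↭⟨ ++⁺ˡ (F x) (↭-prep (b x) (concatMap-∷ʳ-↭ F b xs)) ⟩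
  F x ++ b x ∷ (concat (map F xs) ++ map b xs)               ↭⟨ ++⁺ˡ (F x) (shift (b x) (concat (map F xs)) (map b xs)) ⟨
  F x ++ (concat (map F xs) ++ b x ∷ map b xs)               ≡⟨ ++-assoc (F x) (concat (map F xs)) _ ⟨
  (F x ++ concat (map F xs)) ++ b x ∷ map b xs               ∎
  where open PermutationReasoning

==-≡ : ∀ {n} {x y : Fin n} → x ≡ y → (x == y) ≡ true
==-≡ {x = x} {y} x≡y = trans (isYes≗does (x ≟ᶠ y)) (dec-true (x ≟ᶠ y) x≡y)

==-≢ : ∀ {n} {x y : Fin n} → ¬ x ≡ y → (x == y) ≡ false
==-≢ {x = x} {y} x≢y = trans (isYes≗does (x ≟ᶠ y)) (dec-false (x ≟ᶠ y) x≢y)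

inject₁-== : ∀ {n} (x y : Fin n) → (inject₁ x == inject₁ y) ≡ (x == y)
inject₁-== x y with x ≟ᶠ y
... | yes refl = ==-≡ refl
... | no  x≢y  = ==-≢ (x≢y ∘ inject₁-injective)

inject₁-==-fromℕ : ∀ {n} (x : Fin n) → (inject₁ x == fromℕ n) ≡ false
inject₁-==-fromℕ x = ==-≢ (fromℕ≢inject₁ ∘ sym)

fromℕ-==-inject₁ : ∀ {n} (x : Fin n) → (fromℕ n == inject₁ x) ≡ false
fromℕ-==-inject₁ x = ==-≢ fromℕ≢inject₁

allFin-suc : ∀ m → allFin (suc m) ≡ map inject₁ (allFin m) ++ [ fromℕ m ]
allFin-suc m = trans (tabulate-inject₁ m id) (cong (_++ [ fromℕ m ]) (sym (map-tabulate id inject₁)))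

inject₁<fromℕ : ∀ {m} (i : Fin m) → inject₁ i Fin.< fromℕ m
inject₁<fromℕ {m} i = subst (toℕ (inject₁ i) <_) (sym (toℕ-fromℕ m)) (inject₁ℕ< i)

filter-inject₁<? : ∀ {m} (i : Fin m) (xs : List (Fin m)) →
                   filter (inject₁ i <?_) (map inject₁ xs) ≡ map inject₁ (filter (i <?_) xs)
filter-inject₁<? i xs = trans (filter-map (inject₁ i <?_) inject₁ xs)
                              (cong (map inject₁) (filter-≐ ((inject₁ i <?_) ∘ inject₁) (i <?_) inject₁<≐< xs))
  where
  inject₁<≐< : (λ j → inject₁ i Fin.< inject₁ j) ≐ (i Fin.<_)
  inject₁<≐< = (λ {j} → subst₂ _<_ (toℕ-inject₁ i) (toℕ-inject₁ j))
             , (λ {j} → subst₂ _<_ (sym (toℕ-inject₁ i)) (sym (toℕ-inject₁ j)))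

-- Edge lists up to order and orientation

normalise : ∀ {n} → Edge n → Edge n
normalise (x , y) with y <? x
... | yes _ = (y , x)
... | no  _ = (x , y)

IsSymmetric : ∀ {n} → (Edge n → Bool) → Set
IsSymmetric p = ∀ x y → p (x , y) ≡ p (y , x)

normalise-sym : ∀ {n} {p : Edge n → Bool} → IsSymmetric p → p ∘ normalise ≗ p
normalise-sym p-sym (x , y) with y <? x
... | yes _ = p-sym y x
... | no  _ = refl

infix 4 _≈_
_≈_ : ∀ {n} → Graph n → Graph n → Set
E ≈ E′ = map normalise E ↭ map normalise E′

≈-sym : ∀ {n} {E E′ : Graph n} → E ≈ E′ → E′ ≈ E
≈-sym = ↭-sym

↭⇒≈ : ∀ {n} {E E′ : Graph n} → E ↭ E′ → E ≈ E′
↭⇒≈ = map⁺ normalise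

≈-trans : ∀ {n} {E E′ E″ : Graph n} → E ≈ E′ → E′ ≈ E″ → E ≈ E″
≈-trans = ↭-trans

normalise-flip : ∀ {n} {x y : Fin n} → x Fin.< y → normalise (y , x) ≡ normalise (x , y)
normalise-flip {x = x} {y} x<y with x <? y | y <? x
... | yes _  | no _    = refl
... | no x≮y | _       = contradiction x<y x≮y
... | yes _  | yes y<x = contradiction y<x (<-asym x<y)

flip-≈ : ∀ {n} {x y : Fin n} (E : Graph n) → x Fin.< y → (y , x) ∷ E ≈ (x , y) ∷ E
flip-≈ E x<y = ↭-reflexive (cong (_∷ map normalise E) (normalise-flip x<y))

length-≈ : ∀ {n} {E E′ : Graph n} → E ≈ E′ → length E ≡ length E′
length-≈ {E = E} {E′} E≈E′ =
  trans (sym (length-map normalise E)) (trans (↭-length E≈E′) (length-map normalise E′))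

any-≈ : ∀ {n} {p : Edge n → Bool} → IsSymmetric p → {E E′ : Graph n} → E ≈ E′ → any p E ≡ any p E′
any-≈ {p = p} p-sym {E} {E′} E≈E′ = begin
  any p E                ≡⟨ any-cong (sym ∘ normalise-sym p-sym) E ⟩
  any (p ∘ normalise) E  ≡⟨ any-map p normalise E ⟨
  any p (map normalise E)  ≡⟨ any-↭ p E≈E′ ⟩
  any p (map normalise E′) ≡⟨ any-map p normalise E′ ⟩
  any (p ∘ normalise) E′ ≡⟨ any-cong (normalise-sym p-sym) E′ ⟩
  any p E′               ∎
  where open ≡-Reasoning

touches : ∀ {n} → Fin n → Edge n → Bool
touches v (x , y) = (x == v) ∨ (y == v)

joins : ∀ {n} → (Fin n → Bool) → Fin n → Edge n → Bool
joins R u (x , y) = ((x == u) ∧ R y) ∨ ((y == u) ∧ R x)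

touches-sym : ∀ {n} (v : Fin n) → IsSymmetric (touches v)
touches-sym v x y = ∨-comm (x == v) (y == v)

joins-sym : ∀ {n} (R : Fin n → Bool) u → IsSymmetric (joins R u)
joins-sym R u x y = ∨-comm ((x == u) ∧ R y) ((y == u) ∧ R x)

incident-≈ : ∀ {n} (v : Fin n) {E E′ : Graph n} → E ≈ E′ → incident v E ≡ incident v E′
incident-≈ v = any-≈ (touches-sym v)

step-≈ : ∀ {n} {E E′ : Graph n} → E ≈ E′ → ∀ R → step E R ≗ step E′ R
step-≈ E≈E′ R u = cong (R u ∨_) (any-≈ (joins-sym R u) E≈E′)

step-cong : ∀ {n} (E : Graph n) {R R′ : Fin n → Bool} → R ≗ R′ → step E R ≗ step E R′
step-cong E {R} {R′} R≗R′ u = cong₂ _∨_ (R≗R′ u) (any-cong joins-cong E)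
  where
  joins-cong : joins R u ≗ joins R′ u
  joins-cong (x , y) = cong₂ _∨_ (cong ((x == u) ∧_) (R≗R′ y)) (cong ((y == u) ∧_) (R≗R′ x))

iter-cong : ∀ {n} k (E : Graph n) {R R′ : Fin n → Bool} → R ≗ R′ → iter k E R ≗ iter k E R′
iter-cong zero    E R≗R′ = R≗R′
iter-cong (suc k) E R≗R′ = iter-cong k E (step-cong E R≗R′)

iter-≈ : ∀ {n} k {E E′ : Graph n} → E ≈ E′ → ∀ R → iter k E R ≗ iter k E′ R
iter-≈ zero    E≈E′ R u = refl
iter-≈ (suc k) {E} {E′} E≈E′ R u = trans (iter-cong k E (step-≈ E≈E′ R) u) (iter-≈ k E≈E′ (step E′ R) u)

reach-≈ : ∀ {n} {E E′ : Graph n} → E ≈ E′ → ∀ v → reach E v ≗ reach E′ v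
reach-≈ {n} E≈E′ v = iter-≈ n E≈E′ (_== v)

picks-≈ : ∀ {n} {E E′ : Graph n} {e′ rest′} → E ≈ E′ → (e′ , rest′) ∈ picks E′ →
          ∃₂ λ e rest → (e , rest) ∈ picks E × rest ≈ rest′
picks-≈ {E = E} {E′} E≈E′ e′∈ = picks-map-↭ normalise E (↭-trans E≈E′ (map⁺ normalise (picks-↭ E′ e′∈)))

-- The anonymous functions in herderVal and catVal.
cutValue : ∀ {n} → ℕ → Fin n → Edge n × Graph n → ℕ
cutValue k v (_ , rest) = suc (catVal k rest v)

moveValue : ∀ {n} → ℕ → Graph n → Fin n → Fin n → ℕ
moveValue k E v u = if not (u == v) ∧ reach E v u then herderVal k E u else 0

if-cong : ∀ {b b′ : Bool} {x x′ : ℕ} → b ≡ b′ → x ≡ x′ → (if b then x else 0) ≡ (if b′ then x′ else 0)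
if-cong refl refl = refl

if-≤ : ∀ b x → (if b then x else 0) ≤ x
if-≤ true  x = ≤-refl
if-≤ false x = z≤n

if-≡0 : ∀ b {x} → x ≡ 0 → (if b then x else 0) ≡ 0
if-≡0 b x≡0 = n≤0⇒n≡0 (≤-trans (if-≤ b _) (≤-reflexive x≡0))

mutual
  herderVal-≈ : ∀ {n} k {E E′ : Graph n} v → E ≈ E′ → herderVal k E v ≡ herderVal k E′ v
  herderVal-≈ zero    v E≈E′ = refl
  herderVal-≈ (suc k) v E≈E′ =
    if-cong (incident-≈ v E≈E′) (minList-⊆-cong (cutValues-⊆ (≈-sym E≈E′)) (cutValues-⊆ E≈E′))
    where
    cutValues-⊆ : ∀ {E E′} → E′ ≈ E → map (cutValue k v) (picks E) ⊆ map (cutValue k v) (picks E′)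
    cutValues-⊆ {E} {E′} E′≈E a∈ with ∈-map⁻ (cutValue k v) a∈
    ... | (e , rest) , e,rest∈ , refl with picks-≈ E′≈E e,rest∈
    ...   | e′ , rest′ , e′,rest′∈ , rest′≈rest =
      subst (_∈ map (cutValue k v) (picks E′)) (cong suc (catVal-≈ k v rest′≈rest))
            (∈-map⁺ (cutValue k v) e′,rest′∈)

  catVal-≈ : ∀ {n} k {E E′ : Graph n} v → E ≈ E′ → catVal k E v ≡ catVal k E′ v
  catVal-≈ k v E≈E′ = if-cong (incident-≈ v E≈E′) (maxFin-cong λ u →
    if-cong (cong (not (u == v) ∧_) (reach-≈ E≈E′ v u)) (herderVal-≈ k u E≈E′))

cat-≈ : ∀ {n} {E E′ : Graph n} → E ≈ E′ → cat E ≡ cat E′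
cat-≈ {E = E} {E′} E≈E′ = maxFin-cong λ v →
  trans (cong (λ k → herderVal k E v) (length-≈ E≈E′)) (herderVal-≈ (length E′) v E≈E′)

catVal≤cat : ∀ {n} (E : Graph n) v → catVal (length E) E v ≤ cat E
catVal≤cat E v with incident v E
... | true  = maxFin-mono λ u → if-≤ (not (u == v) ∧ reach E v u) _
... | false = z≤n

cat-∷-≤ : ∀ {n} (e : Edge n) (E : Graph n) → cat (e ∷ E) ≤ suc (cat E)
cat-∷-≤ e E = maxFin-lub herderVal≤
  where
  herderVal≤ : ∀ v → herderVal (suc (length E)) (e ∷ E) v ≤ suc (cat E)
  herderVal≤ v with incident v (e ∷ E)
  ... | true  = ≤-trans (minList-≤ (map (cutValue (length E) v) (picks (e ∷ E))) (here refl)) (s≤s (catVal≤cat E v))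
  ... | false = z≤n

cat-++-≤ : ∀ {n} (D E : Graph n) → cat (D ++ E) ≤ length D + cat E
cat-++-≤ []      E = ≤-refl
cat-++-≤ (d ∷ D) E = ≤-trans (cat-∷-≤ d (D ++ E)) (s≤s (cat-++-≤ D E))

-- Reachability stabilises after n rounds

toSubset : ∀ {n} → (Fin n → Bool) → Subset n
toSubset = Vec.tabulate

∈-toSubset⁺ : ∀ {n} {S : Fin n → Bool} {u} → S u ≡ true → u ∈ˢ toSubset S
∈-toSubset⁺ {S = S} {u} Su = lookup⇒[]= u (toSubset S) (trans (lookup∘tabulate S u) Su)

∈-toSubset⁻ : ∀ {n} {S : Fin n → Bool} {u} → u ∈ˢ toSubset S → S u ≡ true
∈-toSubset⁻ {S = S} {u} u∈S = trans (sym (lookup∘tabulate S u)) ([]=⇒lookup u∈S)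

module _ {n} {S : Fin n → Bool} where

  ∣toSubset∣-full : n ≤ ∣ toSubset S ∣ → ∀ u → S u ≡ true
  ∣toSubset∣-full n≤∣S∣ u = ∈-toSubset⁻ (subst (u ∈ˢ_) (sym S≡⊤) ∈⊤)
    where
    S≡⊤ : toSubset S ≡ ⊤
    S≡⊤ = ∣p∣≡n⇒p≡⊤ (≤-antisym (∣p∣≤n (toSubset S)) n≤∣S∣)

  ∣toSubset∣-< : ∀ {T : Fin n → Bool} → (∀ u → S u ≡ true → T u ≡ true) →
                 ∀ u → S u ≡ false → T u ≡ true → ∣ toSubset S ∣ < ∣ toSubset T ∣
  ∣toSubset∣-< S⊆T u Su≡false Tu≡true = p⊂q⇒∣p∣<∣q∣
    ( (λ {v} v∈S → ∈-toSubset⁺ (S⊆T v (∈-toSubset⁻ v∈S)))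
    , u , ∈-toSubset⁺ Tu≡true , λ u∈S → contradiction (trans (sym (∈-toSubset⁻ u∈S)) Su≡false) λ ())

iter-suc : ∀ {n} k (E : Graph n) R → iter (suc k) E R ≗ step E (iter k E R)
iter-suc zero    E R u = refl
iter-suc (suc k) E R u = iter-suc k E (step E R) u

step-inflationary : ∀ {n} (E : Graph n) R u → R u ≡ true → step E R u ≡ true
step-inflationary E R u Ru≡true rewrite Ru≡true = refl

Stable : ∀ {n} → Graph n → (Fin n → Bool) → Set
Stable E S = step E S ≗ S

stable-cong : ∀ {n} (E : Graph n) {S T} → S ≗ T → Stable E S → Stable E T
stable-cong E S≗T st u = trans (step-cong E (sym ∘ S≗T) u) (trans (st u) (S≗T u))

stable-or-grows : ∀ {n} (E : Graph n) S → Stable E S ⊎ ∃ λ u → S u ≡ false × step E S u ≡ true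
stable-or-grows {n} E S with all? (λ u → step E S u Bool.≟ S u)
... | yes st = inj₁ st
... | no ¬st with ¬∀⟶∃¬ n _ (λ u → step E S u Bool.≟ S u) ¬st
...   | u , stepSu≢Su = inj₂ (u , strict-increase (step-inflationary E S u) stepSu≢Su)

module _ {n} (E : Graph n) (R : Fin n → Bool) where

  iter-stable : ∀ k → Stable E (iter k E R) → iter (suc k) E R ≗ iter k E R
  iter-stable k st u = trans (iter-suc k E R u) (st u)

  iter-inflationary : ∀ k u → iter k E R u ≡ true → iter (suc k) E R u ≡ true
  iter-inflationary k u Su≡true = trans (iter-suc k E R u) (step-inflationary E _ u Su≡true)

  -- Until the iteration is stable, every round adds a vertex.
  stable-or-large : ∀ k → Stable E (iter k E R) ⊎ k ≤ ∣ toSubset (iter k E R) ∣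
  stable-or-large zero = inj₂ z≤n
  stable-or-large (suc k) with stable-or-large k
  ... | inj₁ st = inj₁ (stable-cong E (sym ∘ iter-stable k st) st)
  ... | inj₂ k≤∣S∣ with stable-or-grows E (iter k E R)
  ...   | inj₁ st = inj₁ (stable-cong E (sym ∘ iter-stable k st) st)
  ...   | inj₂ (u , Su≡false , stepSu≡true) = inj₂ (≤-trans (s≤s k≤∣S∣)
          (∣toSubset∣-< (iter-inflationary k) u Su≡false (trans (iter-suc k E R u) stepSu≡true)))

  iter-stabilises : iter (suc n) E R ≗ iter n E R
  iter-stabilises with stable-or-large n
  ... | inj₁ st    = iter-stable n st
  ... | inj₂ n≤∣S∣ = λ u → trans (iter-inflationary n u (full u)) (sym (full u))
    where full = ∣toSubset∣-full n≤∣S∣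

-- Adding an isolated vertex

liftEdge : ∀ {m} → Edge m → Edge (suc m)
liftEdge (i , j) = (inject₁ i , inject₁ j)

lift : ∀ {m} → Graph m → Graph (suc m)
lift = map liftEdge

ExtendsByFalse : ∀ {m} → (Fin (suc m) → Bool) → (Fin m → Bool) → Set
ExtendsByFalse {m} R′ R = R′ ∘ inject₁ ≗ R × R′ (fromℕ m) ≡ false

module _ {m} (E : Graph m) where

  incident-lift : ∀ v → incident (inject₁ v) (lift E) ≡ incident v E
  incident-lift v = trans (any-map (touches (inject₁ v)) liftEdge E) (any-cong touches-lift E)
    where
    touches-lift : touches (inject₁ v) ∘ liftEdge ≗ touches v
    touches-lift (x , y) rewrite inject₁-== x v | inject₁-== y v = refl

  incident-fromℕ-lift : incident (fromℕ m) (lift E) ≡ false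
  incident-fromℕ-lift = trans (any-map (touches (fromℕ m)) liftEdge E) (any-false untouched E)
    where
    untouched : ∀ e → touches (fromℕ m) (liftEdge e) ≡ false
    untouched (x , y) rewrite inject₁-==-fromℕ x | inject₁-==-fromℕ y = refl

  step-lift : ∀ {R′ R} → ExtendsByFalse R′ R → ExtendsByFalse (step (lift E) R′) (step E R)
  step-lift {R′} {R} (R′∘inject₁≗R , R′[top]≡false) = step-inject₁ , step-fromℕ
    where
    step-inject₁ : step (lift E) R′ ∘ inject₁ ≗ step E R
    step-inject₁ u = cong₂ _∨_ (R′∘inject₁≗R u)
                               (trans (any-map (joins R′ (inject₁ u)) liftEdge E) (any-cong joins-lift E))
      where
      joins-lift : joins R′ (inject₁ u) ∘ liftEdge ≗ joins R u
      joins-lift (x , y) rewrite inject₁-== x u | inject₁-== y u | R′∘inject₁≗R x | R′∘inject₁≗R y = refl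
    step-fromℕ : step (lift E) R′ (fromℕ m) ≡ false
    step-fromℕ rewrite R′[top]≡false = trans (any-map (joins R′ (fromℕ m)) liftEdge E) (any-false unjoined E)
      where
      unjoined : ∀ e → joins R′ (fromℕ m) (liftEdge e) ≡ false
      unjoined (x , y) rewrite inject₁-==-fromℕ x | inject₁-==-fromℕ y = refl

  iter-lift : ∀ k {R′ R} → ExtendsByFalse R′ R → ExtendsByFalse (iter k (lift E) R′) (iter k E R)
  iter-lift zero    ext = ext
  iter-lift (suc k) ext = iter-lift k (step-lift ext)

  -- The lifted graph has one more vertex, so its reachability test iterates once more.
  reach-lift : ∀ v u → reach (lift E) (inject₁ v) (inject₁ u) ≡ reach E v u
  reach-lift v u = trans (proj₁ (iter-lift (suc m) ((λ w → inject₁-== w v) , fromℕ-==-inject₁ v)) u)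
                         (iter-stabilises E (_== v) u)

  herderVal-fromℕ-lift : ∀ k → herderVal k (lift E) (fromℕ m) ≡ 0
  herderVal-fromℕ-lift zero    = refl
  herderVal-fromℕ-lift (suc k) = if-cong incident-fromℕ-lift refl

mutual
  herderVal-lift : ∀ {m} k (E : Graph m) v → herderVal k (lift E) (inject₁ v) ≡ herderVal k E v
  herderVal-lift zero    E v = refl
  herderVal-lift (suc k) E v = if-cong (incident-lift E v) (cong minList (begin
    map (cutValue k (inject₁ v)) (picks (lift E))
      ≡⟨ cong (map _) (picks-map liftEdge E) ⟩
    map (cutValue k (inject₁ v)) (map (Product.map liftEdge lift) (picks E))
      ≡⟨ map-∘ (picks E) ⟨
    map (cutValue k (inject₁ v) ∘ Product.map liftEdge lift) (picks E)
      ≡⟨ map-cong (λ { (e , rest) → cong suc (catVal-lift k rest v) }) (picks E) ⟩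
    map (cutValue k v) (picks E) ∎))
    where open ≡-Reasoning

  catVal-lift : ∀ {m} k (E : Graph m) v → catVal k (lift E) (inject₁ v) ≡ catVal k E v
  catVal-lift {m} k E v = if-cong (incident-lift E v) (maxFin-inject₁ moves-lift move-fromℕ)
    where
    moves-lift : moveValue k (lift E) (inject₁ v) ∘ inject₁ ≗ moveValue k E v
    moves-lift u = if-cong (cong₂ _∧_ (cong not (inject₁-== u v)) (reach-lift E v u)) (herderVal-lift k E u)
    move-fromℕ : moveValue k (lift E) (inject₁ v) (fromℕ m) ≡ 0
    move-fromℕ = if-≡0 _ (herderVal-fromℕ-lift E k)

cat-lift : ∀ {m} (E : Graph m) → cat (lift E) ≡ cat E
cat-lift E = maxFin-inject₁
  (λ v → trans (cong (λ k → herderVal k (lift E) (inject₁ v)) (length-map liftEdge E)) (herderVal-lift (length E) E v))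
  (herderVal-fromℕ-lift E (length (lift E)))

-- Complete graphs

row : ∀ n → Fin n → Graph n
row n i = map (i ,_) (filter (i <?_) (allFin n))

row-inject₁ : ∀ m (i : Fin m) → row (suc m) (inject₁ i) ≡ lift (row m i) ++ [ (inject₁ i , fromℕ m) ]
row-inject₁ m i = begin
  map (i′ ,_) (filter (i′ <?_) (allFin (suc m)))
    ≡⟨ cong (map (i′ ,_) ∘ filter (i′ <?_)) (allFin-suc m) ⟩
  map (i′ ,_) (filter (i′ <?_) (map inject₁ (allFin m) ++ [ fromℕ m ]))
    ≡⟨ cong (map (i′ ,_)) (filter-++ (i′ <?_) (map inject₁ (allFin m)) [ fromℕ m ]) ⟩
  map (i′ ,_) (filter (i′ <?_) (map inject₁ (allFin m)) ++ filter (i′ <?_) [ fromℕ m ])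
    ≡⟨ cong (map (i′ ,_))
            (cong₂ _++_ (filter-inject₁<? i (allFin m)) (filter-accept (i′ <?_) (inject₁<fromℕ i))) ⟩
  map (i′ ,_) (map inject₁ L ++ [ fromℕ m ])
    ≡⟨ map-++ (i′ ,_) (map inject₁ L) [ fromℕ m ] ⟩
  map (i′ ,_) (map inject₁ L) ++ [ (i′ , fromℕ m) ]
    ≡⟨ cong (_++ [ (i′ , fromℕ m) ]) (trans (sym (map-∘ {g = i′ ,_} L)) (map-∘ {g = liftEdge} L)) ⟩
  lift (row m i) ++ [ (i′ , fromℕ m) ] ∎
  where
  open ≡-Reasoning
  i′ = inject₁ i
  L  = filter (i <?_) (allFin m)

row-fromℕ : ∀ m → row (suc m) (fromℕ m) ≡ []
row-fromℕ m = cong (map (fromℕ m ,_))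
  (filter-none (fromℕ m <?_) {xs = allFin (suc m)} (All.tabulate λ {j} _ → ≤⇒≯ (≤fromℕ j)))

lastColumn : ∀ m → Graph (suc m)
lastColumn m = map (λ i → (inject₁ i , fromℕ m)) (allFin m)

K-suc : ∀ m → K (suc m) ↭ lift (K m) ++ lastColumn m
K-suc m = begin
  concat (map (row (suc m)) (allFin (suc m)))
    ≡⟨ cong (concat ∘ map (row (suc m))) (allFin-suc m) ⟩
  concat (map (row (suc m)) (map inject₁ (allFin m) ++ [ fromℕ m ]))
    ≡⟨ concatMap-++ (row (suc m)) (map inject₁ (allFin m)) [ fromℕ m ] ⟩
  concat (map (row (suc m)) (map inject₁ (allFin m))) ++ row (suc m) (fromℕ m) ++ []
    ≡⟨ cong₂ _++_ (cong concat (trans (sym (map-∘ (allFin m))) (map-cong (row-inject₁ m) (allFin m))))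
                  (cong (_++ []) (row-fromℕ m)) ⟩
  concat (map (λ i → lift (row m i) ++ [ (inject₁ i , fromℕ m) ]) (allFin m)) ++ []
    ≡⟨ ++-identityʳ _ ⟩
  concat (map (λ i → lift (row m i) ++ [ (inject₁ i , fromℕ m) ]) (allFin m))
    ↭⟨ concatMap-∷ʳ-↭ (lift ∘ row m) (λ i → (inject₁ i , fromℕ m)) (allFin m) ⟩
  concat (map (lift ∘ row m) (allFin m)) ++ lastColumn m
    ≡⟨ cong (_++ lastColumn m) (trans (cong concat (map-∘ (allFin m))) (concat-map (map (row m) (allFin m)))) ⟩
  lift (K m) ++ lastColumn m ∎
  where open PermutationReasoning

pendant-≈ : ∀ m (w : Fin m) → pendant m w ≈ (fromℕ m , inject₁ w) ∷ lift (K m)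
pendant-≈ m w = ↭⇒≈ (++-comm (lift (K m)) [ (fromℕ m , inject₁ w) ])

K-suc-≈-pendant : ∀ m (w : Fin m) → ∃ λ D → suc (length D) ≡ m × K (suc m) ≈ D ++ pendant m w
K-suc-≈-pendant m w with ∈-∃++ (∈-map⁺ (λ i → (inject₁ i , fromℕ m)) (∈-allFin w))
... | ys , zs , column≡ = ys ++ zs , length-D , K≈
  where
  x  = (inject₁ w , fromℕ m)
  x′ = (fromℕ m , inject₁ w)
  D  = ys ++ zs
  length-D : suc (length D) ≡ m
  length-D = begin
    suc (length D)            ≡⟨ length-++-sucʳ ys x zs ⟨
    length (ys ++ x ∷ zs)     ≡⟨ cong length column≡ ⟨
    length (lastColumn m)     ≡⟨ length-map _ (allFin m) ⟩
    length (allFin m)         ≡⟨ length-tabulate id ⟩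
    m                         ∎
    where open ≡-Reasoning
  K↭ : K (suc m) ↭ x ∷ (D ++ lift (K m))
  K↭ = begin
    K (suc m)                   ↭⟨ K-suc m ⟩
    lift (K m) ++ lastColumn m  ≡⟨ cong (lift (K m) ++_) column≡ ⟩
    lift (K m) ++ ys ++ x ∷ zs  ↭⟨ ++⁺ˡ (lift (K m)) (shift x ys zs) ⟩
    lift (K m) ++ x ∷ D         ↭⟨ shift x (lift (K m)) D ⟩
    x ∷ (lift (K m) ++ D)       ↭⟨ ↭-prep x (++-comm (lift (K m)) D) ⟩
    x ∷ (D ++ lift (K m))       ∎
    where open PermutationReasoning
  ↭pendant : x′ ∷ (D ++ lift (K m)) ↭ D ++ pendant m w
  ↭pendant = ↭-trans (↭-sym (shift x′ D (lift (K m)))) (++⁺ˡ D (∷↭∷ʳ x′ (lift (K m))))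
  K≈ : K (suc m) ≈ D ++ pendant m w
  K≈ = ≈-trans (↭⇒≈ K↭)
               (≈-trans (≈-sym (flip-≈ (D ++ lift (K m)) (inject₁<fromℕ w))) (↭⇒≈ ↭pendant))

cat-pendant-≤ : ∀ m (w : Fin m) → cat (pendant m w) ≤ suc (cat (K m))
cat-pendant-≤ m w = begin
  cat (pendant m w)                          ≡⟨ cat-≈ (pendant-≈ m w) ⟩
  cat ((fromℕ m , inject₁ w) ∷ lift (K m))   ≤⟨ cat-∷-≤ _ (lift (K m)) ⟩
  suc (cat (lift (K m)))                     ≡⟨ cong suc (cat-lift (K m)) ⟩
  suc (cat (K m))                            ∎
  where open ≤-Reasoning

cat-K-suc-≤ : ∀ m (w : Fin m) → suc (cat (K (suc m))) ≤ m + cat (pendant m w)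
cat-K-suc-≤ m w with K-suc-≈-pendant m w
... | D , suc∣D∣≡m , K≈ = begin
  suc (cat (K (suc m)))              ≡⟨ cong suc (cat-≈ K≈) ⟩
  suc (cat (D ++ pendant m w))       ≤⟨ s≤s (cat-++-≤ D (pendant m w)) ⟩
  suc (length D) + cat (pendant m w) ≡⟨ cong (_+ cat (pendant m w)) suc∣D∣≡m ⟩
  m + cat (pendant m w)              ∎
  where open ≤-Reasoning

-- The sequence c

n∸n/2<n : ∀ n → 2 ≤ n → n ∸ n / 2 < n
n∸n/2<n n 2≤n = ∸-monoʳ-< (m≥n⇒m/n>0 2≤n) (m/n≤m n 2)

cAux-fuel : ∀ {f g} n → n ≤ f → n ≤ g → cAux f n ≡ cAux g n
cAux-fuel {zero}  {zero}  0 _ _ = refl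
cAux-fuel {zero}  {suc g} 0 _ _ = refl
cAux-fuel {suc f} {zero}  0 _ _ = refl
cAux-fuel {suc f} {suc g} 0 _ _ = refl
cAux-fuel {suc f} {suc g} 1 _ _ = refl
cAux-fuel {suc f} {suc g} 2 _ _ = refl
cAux-fuel {suc f} {suc g} 3 _ _ = refl
cAux-fuel {suc f} {suc g} n@(suc (suc (suc (suc _)))) (s≤s n≤1+f) (s≤s n≤1+g) =
  cong (n / 2 * (n ∸ n / 2) +_) (cAux-fuel (n ∸ n / 2) (≤-trans n∸n/2≤ n≤1+f) (≤-trans n∸n/2≤ n≤1+g))
  where
  n∸n/2≤ : n ∸ n / 2 ≤ pred n
  n∸n/2≤ = s≤s⁻¹ (n∸n/2<n n (s≤s (s≤s z≤n)))

c-unfold : ∀ {n h} → 4 ≤ n → n / 2 ≡ h → c n ≡ h * (n ∸ h) + c (n ∸ h)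
c-unfold {n@(suc (suc (suc (suc _))))} (s≤s (s≤s (s≤s (s≤s _)))) refl =
  cong (n / 2 * (n ∸ n / 2) +_) (cAux-fuel (n ∸ n / 2) (s≤s⁻¹ (n∸n/2<n n (s≤s (s≤s z≤n)))) ≤-refl)

m*2∸m≡m : ∀ m → m * 2 ∸ m ≡ m
m*2∸m≡m m = trans (cong (_∸ m) (*-comm m 2)) (trans (cong (λ k → m + k ∸ m) (+-identityʳ m)) (m+n∸m≡n m m))

c-double : ∀ {k} → 2 ≤ k → c (k * 2) ≡ k * k + c k
c-double {k} 2≤k = trans (c-unfold (*-monoˡ-≤ 2 2≤k) (m*n/n≡m k 2)) (cong (λ j → k * j + c j) (m*2∸m≡m k))

c-double+1 : ∀ {k} → 2 ≤ k → c (suc (k * 2)) ≡ k * suc k + c (suc k)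
c-double+1 {k} 2≤k = trans (c-unfold (m≤n⇒m≤1+n (*-monoˡ-≤ 2 2≤k)) half) (cong (λ j → k * j + c j) ⌈half⌉)
  where
  half : suc (k * 2) / 2 ≡ k
  half = trans (+-distrib-/-∣ʳ 1 {d = 2} (divides-refl k)) (m*n/n≡m k 2)
  ⌈half⌉ : suc (k * 2) ∸ k ≡ suc k
  ⌈half⌉ = trans (+-∸-assoc 1 (m≤m*n k 2)) (cong suc (m*2∸m≡m k))

c-suc-double : ∀ {k} → 2 ≤ k → c (suc k) ≡ c k + k → c (suc (k * 2)) ≡ c (k * 2) + k * 2
c-suc-double {k} 2≤k c-suc-k = begin
  c (suc (k * 2))         ≡⟨ c-double+1 2≤k ⟩
  k * suc k + c (suc k)   ≡⟨ cong (k * suc k +_) c-suc-k ⟩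
  k * suc k + (c k + k)   ≡⟨ rearrange k (c k) ⟩
  (k * k + c k) + k * 2   ≡⟨ cong (_+ k * 2) (c-double 2≤k) ⟨
  c (k * 2) + k * 2       ∎
  where
  open ≡-Reasoning
  rearrange : ∀ k x → k * suc k + (x + k) ≡ (k * k + x) + k * 2
  rearrange = solve-∀

2≤3*2^a : ∀ a → 2 ≤ 3 * 2 ^ a
2≤3*2^a a = ≤-trans (s≤s (s≤s z≤n)) (*-monoʳ-≤ 3 (m^n>0 2 a))

c-suc-3*2^a : ∀ a → c (suc (3 * 2 ^ a)) ≡ c (3 * 2 ^ a) + 3 * 2 ^ a
c-suc-3*2^a zero    = refl
c-suc-3*2^a (suc a) = subst (λ n → c (suc n) ≡ c n + n) (sym 3*2^[1+a]≡3*2^a*2)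
                        (c-suc-double (2≤3*2^a a) (c-suc-3*2^a a))
  where
  3*2^[1+a]≡3*2^a*2 : 3 * 2 ^ suc a ≡ 3 * 2 ^ a * 2
  3*2^[1+a]≡3*2^a*2 = trans (cong (3 *_) (*-comm 2 (2 ^ a))) (sym (*-assoc 3 (2 ^ a) 2))

mainTheorem15 : (a : ℕ) →
    ((n : ℕ) → 2 ≤ n → n ≤ 3 * 2 ^ a + 1 → cat (K n) ≡ c n) →
    (w : Fin (3 * 2 ^ a)) →
    cat (pendant (3 * 2 ^ a) w) ≡ cat (K (3 * 2 ^ a)) + 1
mainTheorem15 a cat-K≡c w = ≤-antisym upper lower
  where
  m = 3 * 2 ^ a
  G = pendant m w
  cat-K-suc : cat (K (suc m)) ≡ cat (K m) + m
  cat-K-suc = begin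
    cat (K (suc m)) ≡⟨ cat-K≡c (suc m) (m≤n⇒m≤1+n (2≤3*2^a a)) (≤-reflexive (+-comm 1 m)) ⟩
    c (suc m)       ≡⟨ c-suc-3*2^a a ⟩
    c m + m         ≡⟨ cong (_+ m) (cat-K≡c m (2≤3*2^a a) (m≤m+n m 1)) ⟨
    cat (K m) + m   ∎
    where open ≡-Reasoning
  upper : cat G ≤ cat (K m) + 1
  upper = subst (cat G ≤_) (+-comm 1 (cat (K m))) (cat-pendant-≤ m w)
  lower : cat (K m) + 1 ≤ cat G
  lower = +-cancelˡ-≤ m _ _ (begin
    m + (cat (K m) + 1)   ≡⟨ trans (+-comm m _) (cong (_+ m) (+-comm (cat (K m)) 1)) ⟩
    suc (cat (K m) + m)   ≡⟨ cong suc cat-K-suc ⟨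
    suc (cat (K (suc m))) ≤⟨ cat-K-suc-≤ m w ⟩
    m + cat G             ∎)
    where open ≤-Reasoning
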